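{- Let $t$ be a PCF term of type $\iota$. Then the following are logically equivalent: \[\mathrm{isdefined}([\![t]\!]),\qquad \sum_{n:\mathbb N}t\leadsto^*\underline n,\qquad \Big\|\sum_{n:\mathbb N}t\leadsto^*\underline n\Big\|.\]
   Context: Ambient theory: intensional Martin-Löf type theory with function extensionality, propositional extensionality and propositional truncation $\|-\|$. There are universes $\mathcal U_0:\mathcal U_1$, and $\Omega$ is the type of propositions in $\mathcal U_0$. PCF types are $\iota$ and $\sigma\Rightarrow\tau$. PCF terms are generated inductively by the following constants and application: - $\mathsf{zero}:\iota$; - $\mathsf{succ},\mathsf{pred}:\iota\Rightarrow\iota$; - $\mathsf{ifz}:\iota\Rightarrow\iota\Rightarrow\iota\Rightarrow\iota$; - $\mathsf k_{\sigma,\tau}:\sigma\Rightarrow\tau\Rightarrow\sigma$; - $\mathsf s_{\sigma,\tau,\rho}:(\sigma\Rightarrow\tau\Rightarrow\rho)\Rightarrow(\sigma\Rightarrow\tau)\Rightarrow\sigma\Rightarrow\rho$; - $\mathsf{fix}_\sigma:(\sigma\Rightarrow\sigma)\Rightarrow\sigma$; - application $st$. Numerals: $\underline0=\mathsf{zero}$ and $\underline{n+1}=\mathsf{succ}\,\underline n$. The relation $\tilde\leadsto$ is the inductive family generated by: - $\mathsf{pred}\,\underline0\tilde\leadsto\underline0$; - $\mathsf{pred}\,\underline{n+1}\tilde\leadsto\underline n$; - $\mathsf{ifz}\,s\,t\,\underline0\tilde\leadsto s$; - $\mathsf{ifz}\,s\,t\,\underline{n+1}\tilde\leadsto t$; -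 $\mathsf kst\tilde\leadsto s$; - $\mathsf sfgt\tilde\leadsto ft(gt)$; - $\mathsf{fix}\,f\tilde\leadsto f(\mathsf{fix}\,f)$; - if $f\tilde\leadsto g$ then $ft\tilde\leadsto gt$; - congruence under $\mathsf{succ}$ and $\mathsf{pred}$; - congruence in the last argument of $\mathsf{ifz}$. Set $s\leadsto t:=\|s\tilde\leadsto t\|$. The relation $\leadsto^*$ is $\|\cdot\|$ applied to the inductive reflexive-transitive closure (constructors: extend, refl, trans) of $\leadsto$. Semantics. The lifting is $\mathcal L(X)=\sum_{P:\Omega}(P\to X)$ with $\mathrm{isdefined}=\mathsf{pr}_1$ and $\mathrm{value}(P,\varphi)(p)=\varphi(p)$. We write $\eta(x)=(\mathbf 1,\lambda t.x)$ and $\bot=(\mathbf 0,!)$. The order is $l\sqsubseteq m:=(\mathrm{isdefined}(l)\to l=m)$, and directed suprema are $(\|\sum_i\mathrm{isdefined}(u_i)\|,\phi)$. $[\![\iota]\!]=\mathcal L(\mathbb N)$, and $[\![\sigma\Rightarrow\tau]\!]$ is the dcpo with $\bot$ of continuous maps with the pointwise order. Interpretation of terms: - $[\![\mathsf{zero}]\!]=\eta(0)$; - $[\![\mathsf{succ}]\!]=\mathcal L(\mathrm{succ})$ and $[\![\mathsf{pred}]\!]=\mathcal L(\mathrm{pred})$, where $\mathcal L(f)(P,\varphi)=(P,f\circ\varphi)$; - $[\![\mathsf{ifz}]\!]=\lambda x,y.(\chi_{x,y})^\#$, where $\chi_{x,y}(0)=x$, $\chi_{x,y}(n+1)=y$,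 and $g^\#(P,\varphi)=(\sum_{p:P}\mathrm{isdefined}(g(\varphi p)),(p,d)\mapsto\mathrm{value}(g(\varphi p))(d))$; - $[\![\mathsf k]\!]=\lambda x,y.x$; - $[\![\mathsf s]\!]=\lambda f,g,x.f(x)(g(x))$; - $[\![\mathsf{fix}]\!](f)=\bigsqcup_n f^n(\bot)$; - $[\![st]\!]=[\![s]\!]([\![t]\!])$. -}

module Defs where

open import Level using (Level; Setω)
open import Data.Nat using (ℕ; zero; suc; _+_; pred)
open import Data.Nat.Properties using (+-comm)
open import Data.Bool using (Bool; true; false)
open import Data.Product using (Σ; _×_; _,_; proj₁; proj₂)
open import Data.Unit using (⊤; tt)
open import Data.Empty using (⊥)
open import Function using (_∘_)
open import Relation.Binary.PropositionalEquality
open import Axiom.UniquenessOfIdentityProofs.WithK using (uip)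

isProp : ∀ {ℓ} → Set ℓ → Set ℓ
isProp A = (x y : A) → x ≡ y

record PropTrunc : Setω where
  field
    ∥_∥ : ∀ {ℓ} → Set ℓ → Set ℓ
    ∥∥-isProp : ∀ {ℓ} {A : Set ℓ} → isProp ∥ A ∥
    ∣_∣ : ∀ {ℓ} {A : Set ℓ} → A → ∥ A ∥
    ∥∥-rec : ∀ {ℓ ℓ'} {A : Set ℓ} {B : Set ℓ'} → isProp B → (A → B) → ∥ A ∥ → B

FunExt : Setω
FunExt = ∀ {ℓ ℓ'} {A : Set ℓ} {B : A → Set ℓ'} {f g : (x : A) → B x}
         → ((x : A) → f x ≡ g x) → f ≡ g

PropExt : Set₁
PropExt = {P Q : Set} → isProp P → isProp Q → (P → Q) → (Q → P) → P ≡ Q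

infixr 30 _⇒_
data Ty : Set where
  ι   : Ty
  _⇒_ : Ty → Ty → Ty

infixl 40 _·_
data Term : Ty → Set where
  zero' : Term ι
  succ' : Term (ι ⇒ ι)
  pred' : Term (ι ⇒ ι)
  ifz   : Term (ι ⇒ ι ⇒ ι ⇒ ι)
  𝐤     : {σ τ : Ty} → Term (σ ⇒ τ ⇒ σ)
  𝐬     : {σ τ ρ : Ty} → Term ((σ ⇒ τ ⇒ ρ) ⇒ (σ ⇒ τ) ⇒ σ ⇒ ρ)
  fix   : {σ : Ty} → Term ((σ ⇒ σ) ⇒ σ)
  _·_   : {σ τ : Ty} → Term (σ ⇒ τ) → Term σ → Term τ

numeral : ℕ → Term ι
numeral zero    = zero'
numeral (suc n) = succ' · numeral n

infix 20 _~⇝_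
data _~⇝_ : {σ : Ty} → Term σ → Term σ → Set where
  pred-zero : pred' · numeral zero ~⇝ numeral zero
  pred-suc  : (n : ℕ) → pred' · numeral (suc n) ~⇝ numeral n
  ifz-zero  : (s t : Term ι) → ifz · s · t · numeral zero ~⇝ s
  ifz-suc   : (s t : Term ι) (n : ℕ) → ifz · s · t · numeral (suc n) ~⇝ t
  k-step    : {σ τ : Ty} (s : Term σ) (t : Term τ) → 𝐤 · s · t ~⇝ s
  s-step    : {σ τ ρ : Ty} (f : Term (σ ⇒ τ ⇒ ρ)) (g : Term (σ ⇒ τ)) (t : Term σ)
              → 𝐬 · f · g · t ~⇝ f · t · (g · t)
  fix-step  : {σ : Ty} (f : Term (σ ⇒ σ)) → fix · f ~⇝ f · (fix · f)
  app-cong  : {σ τ : Ty} {f g : Term (σ ⇒ τ)} (t : Term σ) → f ~⇝ g → f · t ~⇝ g · t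
  succ-cong : {s t : Term ι} → s ~⇝ t → succ' · s ~⇝ succ' · t
  pred-cong : {s t : Term ι} → s ~⇝ t → pred' · s ~⇝ pred' · t
  ifz-cong  : (s t : Term ι) {r r' : Term ι} → r ~⇝ r' → ifz · s · t · r ~⇝ ifz · s · t · r'

data Star {A : Set} (R : A → A → Set) : A → A → Set where
  extend : {x y : A} → R x y → Star R x y
  refl*  : {x : A} → Star R x x
  trans* : {x y z : A} → Star R x y → Star R y z → Star R x z

module Model (pt : PropTrunc) (fe : FunExt) (pe : PropExt) where
  open PropTrunc pt public

  infix 20 _⇝_ _⇝*_
  _⇝_ : {σ : Ty} → Term σ → Term σ → Set
  s ⇝ t = ∥ s ~⇝ t ∥

  _⇝*_ : {σ : Ty} → Term σ → Term σ → Set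
  s ⇝* t = ∥ Star _⇝_ s t ∥

  ∥∥-map : ∀ {a b} {A : Set a} {B : Set b} → (A → B) → ∥ A ∥ → ∥ B ∥
  ∥∥-map f = ∥∥-rec ∥∥-isProp (λ a → ∣ f a ∣)

  fe-impl : ∀ {a b} {A : Set a} {B : A → Set b} {f g : {x : A} → B x}
            → ((x : A) → f {x} ≡ g {x}) → (λ {x} → f {x}) ≡ (λ {x} → g {x})
  fe-impl h = cong (λ F {x} → F x) (fe h)

  isProp-isProp : ∀ {ℓ} {A : Set ℓ} → isProp (isProp A)
  isProp-isProp p q = fe λ x → fe λ y → uip (p x y) (q x y)

  Σ≡prop : ∀ {a b} {A : Set a} {B : A → Set b} → ((x : A) → isProp (B x))
           → {u v : Σ A B} → proj₁ u ≡ proj₁ v → u ≡ v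
  Σ≡prop pB {a , b} {.a , b'} refl = cong (a ,_) (pB a b b')

  Σ-isProp : ∀ {a b} {A : Set a} {B : A → Set b} → isProp A → ((x : A) → isProp (B x))
             → isProp (Σ A B)
  Σ-isProp pA pB u v = Σ≡prop pB (pA _ _)

  Ω : Set₁
  Ω = Σ Set isProp

  𝓛 : Set → Set₁
  𝓛 X = Σ Ω (λ P → proj₁ P → X)

  isdefined : {X : Set} → 𝓛 X → Set
  isdefined l = proj₁ (proj₁ l)

  isdefined-isProp : {X : Set} (l : 𝓛 X) → isProp (isdefined l)
  isdefined-isProp l = proj₂ (proj₁ l)

  value : {X : Set} (l : 𝓛 X) → isdefined l → X
  value l = proj₂ l

  η : {X : Set} → X → 𝓛 X
  η x = (⊤ , (λ _ _ → refl)) , (λ _ → x)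

  ⊥𝓛 : {X : Set} → 𝓛 X
  ⊥𝓛 = (⊥ , (λ ())) , (λ ())

  value-≡ : {X : Set} {l m : 𝓛 X} → l ≡ m → (p : isdefined l) (q : isdefined m)
            → value l p ≡ value m q
  value-≡ {l = l} refl p q = cong (value l) (isdefined-isProp l p q)

  private
    𝓛-ext' : {X : Set} (P Q : Set) (pP : isProp P) (pQ : isProp Q) (φ : P → X) (ψ : Q → X)
             (f : P → Q) → P ≡ Q → ((p : P) → φ p ≡ ψ (f p))
             → _≡_ {A = 𝓛 X} ((P , pP) , φ) ((Q , pQ) , ψ)
    𝓛-ext' P .P pP pQ φ ψ f refl h with isProp-isProp pP pQ
    ... | refl = cong (λ χ → (P , pP) , χ) (fe λ p → trans (h p) (cong ψ (pP (f p) p)))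

  𝓛-ext : {X : Set} {l m : 𝓛 X} (f : isdefined l → isdefined m) (g : isdefined m → isdefined l)
          → ((p : isdefined l) → value l p ≡ value m (f p)) → l ≡ m
  𝓛-ext {l = (P , pP) , φ} {(Q , pQ) , ψ} f g h = 𝓛-ext' P Q pP pQ φ ψ f (pe pP pQ f g) h

  isDirected : {C : Set₁} (_⊑_ : C → C → Set₁) {I : Set} → (I → C) → Set₁
  isDirected _⊑_ {I} α = ∥ I ∥ × ((i j : I) → ∥ Σ I (λ k → (α i ⊑ α k) × (α j ⊑ α k)) ∥)

  isSup : {C : Set₁} (_⊑_ : C → C → Set₁) {I : Set} → C → (I → C) → Set₁
  isSup _⊑_ {I} x α = ((i : I) → α i ⊑ x) × ((y : _) → ((i : I) → α i ⊑ y) → x ⊑ y)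

  -- (carriers are automatically sets here, since Agda is used with K)
  record DCPO⊥ : Set₂ where
    field
      carrier   : Set₁
      _⊑_       : carrier → carrier → Set₁
      ⊑-prop    : (x y : carrier) → isProp (x ⊑ y)
      ⊑-refl    : (x : carrier) → x ⊑ x
      ⊑-trans   : {x y z : carrier} → x ⊑ y → y ⊑ z → x ⊑ z
      ⊑-antisym : {x y : carrier} → x ⊑ y → y ⊑ x → x ≡ y
      bot       : carrier
      bot-least : (x : carrier) → bot ⊑ x
      ∐         : {I : Set} (α : I → carrier) → isDirected _⊑_ α → carrier
      ∐-sup     : {I : Set} (α : I → carrier) (δ : isDirected _⊑_ α) → isSup _⊑_ (∐ α δ) α

  open DCPO⊥ public using (carrier; ⊑-prop; ⊑-refl; ⊑-trans; ⊑-antisym; bot; bot-least; ∐; ∐-sup)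

  ⟨_⟩ : DCPO⊥ → Set₁
  ⟨ D ⟩ = carrier D

  Rel : (D : DCPO⊥) → ⟨ D ⟩ → ⟨ D ⟩ → Set₁
  Rel D = DCPO⊥._⊑_ D
  syntax Rel D x y = x ⊑⟨ D ⟩ y

  isContinuous : (D E : DCPO⊥) → (⟨ D ⟩ → ⟨ E ⟩) → Set₁
  isContinuous D E f = {I : Set} (α : I → ⟨ D ⟩) (δ : isDirected (Rel D) α)
                       → isSup (Rel E) (f (∐ D α δ)) (λ i → f (α i))

  sup-unique : (D : DCPO⊥) {I : Set} {α : I → ⟨ D ⟩} {x y : ⟨ D ⟩}
               → isSup (Rel D) x α → isSup (Rel D) y α → x ≡ y
  sup-unique D sx sy = ⊑-antisym D (proj₂ sx _ (proj₁ sy)) (proj₂ sy _ (proj₁ sx))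

  isProp-isSup : (D : DCPO⊥) {I : Set} (x : ⟨ D ⟩) (α : I → ⟨ D ⟩) → isProp (isSup (Rel D) x α)
  isProp-isSup D x α (a , b) (a' , b') =
    cong₂ _,_ (fe λ i → ⊑-prop D _ _ (a i) (a' i))
              (fe λ y → fe λ h → ⊑-prop D _ _ (b y h) (b' y h))

  isProp-cont : (D E : DCPO⊥) (f : ⟨ D ⟩ → ⟨ E ⟩) → isProp (isContinuous D E f)
  isProp-cont D E f c c' = fe-impl λ I → fe λ α → fe λ δ → isProp-isSup E _ _ (c α δ) (c' α δ)

  module _ (D : DCPO⊥) where
    two : ⟨ D ⟩ → ⟨ D ⟩ → Bool → ⟨ D ⟩
    two x y false = x
    two x y true  = y

    two-up : {x y : ⟨ D ⟩} → x ⊑⟨ D ⟩ y → (i : Bool) → two x y i ⊑⟨ D ⟩ y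
    two-up le false = le
    two-up le true  = ⊑-refl D _

    two-dir : {x y : ⟨ D ⟩} → x ⊑⟨ D ⟩ y → isDirected (Rel D) (two x y)
    two-dir le = ∣ true ∣ , λ i j → ∣ true , two-up le i , two-up le j ∣

  cont→mono : (D E : DCPO⊥) (f : ⟨ D ⟩ → ⟨ E ⟩) → isContinuous D E f
              → {x y : ⟨ D ⟩} → x ⊑⟨ D ⟩ y → f x ⊑⟨ E ⟩ f y
  cont→mono D E f c {x} {y} le =
    subst (λ z → f x ⊑⟨ E ⟩ f z) e (proj₁ (c (two D x y) (two-dir D le)) false)
    where
      e : ∐ D (two D x y) (two-dir D le) ≡ y
      e = sup-unique D (∐-sup D _ _) (two-up D le , λ z h → h true)

  image-dir : (D E : DCPO⊥) (f : ⟨ D ⟩ → ⟨ E ⟩)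
              → ({x y : ⟨ D ⟩} → x ⊑⟨ D ⟩ y → f x ⊑⟨ E ⟩ f y)
              → {I : Set} {α : I → ⟨ D ⟩} → isDirected (Rel D) α → isDirected (Rel E) (λ i → f (α i))
  image-dir D E f m δ = proj₁ δ , λ i j → ∥∥-map (λ { (k , a , b) → k , m a , m b }) (proj₂ δ i j)

  cont-preserves : (D E : DCPO⊥) (f : ⟨ D ⟩ → ⟨ E ⟩) → isContinuous D E f
                   → {I : Set} {α : I → ⟨ D ⟩} → isDirected (Rel D) α → {x : ⟨ D ⟩}
                   → isSup (Rel D) x α → isSup (Rel E) (f x) (λ i → f (α i))
  cont-preserves D E f c {α = α} δ {x} sx =
    subst (λ z → isSup (Rel E) (f z) (λ i → f (α i))) (sup-unique D (∐-sup D α δ) sx) (c α δ)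

  const-cont : (D E : DCPO⊥) (e : ⟨ E ⟩) → isContinuous D E (λ _ → e)
  const-cont D E e α δ = (λ i → ⊑-refl E e) , λ y h → ∥∥-rec (⊑-prop E e y) h (proj₁ δ)

  id-cont : (D : DCPO⊥) → isContinuous D D (λ x → x)
  id-cont D α δ = ∐-sup D α δ

  comp-cont : (D E F : DCPO⊥) (f : ⟨ D ⟩ → ⟨ E ⟩) (g : ⟨ E ⟩ → ⟨ F ⟩)
              → isContinuous D E f → isContinuous E F g → isContinuous D F (λ x → g (f x))
  comp-cont D E F f g cf cg α δ =
    cont-preserves E F g cg (image-dir D E f (cont→mono D E f cf) δ) (cf α δ)

  module Exp (D E : DCPO⊥) where
    FC : Set₁
    FC = Σ (⟨ D ⟩ → ⟨ E ⟩) (isContinuous D E)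

    _≤_ : FC → FC → Set₁
    f ≤ g = (x : ⟨ D ⟩) → proj₁ f x ⊑⟨ E ⟩ proj₁ g x

    pw-dir : {I : Set} (α : I → FC) → isDirected _≤_ α → (x : ⟨ D ⟩)
             → isDirected (Rel E) (λ i → proj₁ (α i) x)
    pw-dir α δ x = proj₁ δ , λ i j → ∥∥-map (λ { (k , a , b) → k , a x , b x }) (proj₂ δ i j)

    pw-∐ : {I : Set} (α : I → FC) → isDirected _≤_ α → ⟨ D ⟩ → ⟨ E ⟩
    pw-∐ α δ x = ∐ E (λ i → proj₁ (α i) x) (pw-dir α δ x)

    pw-∐-cont : {I : Set} (α : I → FC) (δ : isDirected _≤_ α) → isContinuous D E (pw-∐ α δ)
    pw-∐-cont α δ β ε = ub , lb
      where
        ub : ∀ j → pw-∐ α δ (β j) ⊑⟨ E ⟩ pw-∐ α δ (∐ D β ε)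
        ub j = proj₂ (∐-sup E _ _) _
                 (λ i → ⊑-trans E (proj₁ (proj₂ (α i) β ε) j) (proj₁ (∐-sup E _ (pw-dir α δ _)) i))
        lb : ∀ y → (∀ j → pw-∐ α δ (β j) ⊑⟨ E ⟩ y) → pw-∐ α δ (∐ D β ε) ⊑⟨ E ⟩ y
        lb y h = proj₂ (∐-sup E _ _) y
                   (λ i → proj₂ (proj₂ (α i) β ε) y
                     (λ j → ⊑-trans E (proj₁ (∐-sup E _ (pw-dir α δ (β j))) i) (h j)))

  infixr 30 _⟹_
  _⟹_ : DCPO⊥ → DCPO⊥ → DCPO⊥
  D ⟹ E = record
    { carrier   = FC
    ; _⊑_       = _≤_
    ; ⊑-prop    = λ f g p q → fe λ x → ⊑-prop E _ _ (p x) (q x)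
    ; ⊑-refl    = λ f x → ⊑-refl E _
    ; ⊑-trans   = λ p q x → ⊑-trans E (p x) (q x)
    ; ⊑-antisym = λ p q → Σ≡prop (isProp-cont D E) (fe λ x → ⊑-antisym E (p x) (q x))
    ; bot       = (λ _ → bot E) , const-cont D E (bot E)
    ; bot-least = λ f x → bot-least E _
    ; ∐         = λ α δ → pw-∐ α δ , pw-∐-cont α δ
    ; ∐-sup     = λ α δ → (λ i x → proj₁ (∐-sup E _ (pw-dir α δ x)) i)
                        , (λ g h x → proj₂ (∐-sup E _ (pw-dir α δ x)) (proj₁ g x) (λ i → h i x))
    }
    where open Exp D E

  curry-cont : (A D E : DCPO⊥) (F : ⟨ A ⟩ → ⟨ D ⟩ → ⟨ E ⟩)
               (cF : (a : ⟨ A ⟩) → isContinuous D E (F a))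
               (cF' : (d : ⟨ D ⟩) → isContinuous A E (λ a → F a d))
               → isContinuous A (D ⟹ E) (λ a → F a , cF a)
  curry-cont A D E F cF cF' α δ =
    (λ i d → proj₁ (cF' d α δ) i) , (λ g h d → proj₂ (cF' d α δ) (proj₁ g d) (λ i → h i d))

  eval-cont : (D E : DCPO⊥) (d : ⟨ D ⟩) → isContinuous (D ⟹ E) E (λ f → proj₁ f d)
  eval-cont D E d α δ = ∐-sup E _ _

  mono-el : (D E : DCPO⊥) (f : ⟨ D ⟹ E ⟩) {x y : ⟨ D ⟩} → x ⊑⟨ D ⟩ y → proj₁ f x ⊑⟨ E ⟩ proj₁ f y
  mono-el D E f = cont→mono D E (proj₁ f) (proj₂ f)

  _⊑L_ : 𝓛 ℕ → 𝓛 ℕ → Set₁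
  l ⊑L m = isdefined l → l ≡ m

  module LSup {I : Set} (α : I → 𝓛 ℕ) (δ : isDirected _⊑L_ α) where
    Dom : Set
    Dom = Σ I (λ i → isdefined (α i))

    v : Dom → ℕ
    v (i , p) = value (α i) p

    v-const : (a b : Dom) → v a ≡ v b
    v-const (i , p) (j , q) =
      ∥∥-rec (λ x y → uip x y)
        (λ { (k , a , b) → trans (value-≡ (a p) p (subst isdefined (a p) p))
                                  (sym (value-≡ (b q) q (subst isdefined (a p) p))) })
        (proj₂ δ i j)

    Img : Set
    Img = Σ ℕ (λ n → ∥ Σ Dom (λ a → v a ≡ n) ∥)

    Img-prop : isProp Img
    Img-prop (n , x) (m , y) = Σ≡prop (λ _ → ∥∥-isProp)
      (∥∥-rec (λ _ _ → uip _ _)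
        (λ { (a , e) → ∥∥-rec (λ _ _ → uip _ _)
                          (λ { (b , e') → trans (sym e) (trans (v-const a b) e') }) y }) x)

    toImg : ∥ Dom ∥ → Img
    toImg = ∥∥-rec Img-prop (λ a → v a , ∣ a , refl ∣)

    ∐L : 𝓛 ℕ
    ∐L = (∥ Dom ∥ , ∥∥-isProp) , (λ d → proj₁ (toImg d))

    toImg-β : (a : Dom) (d : ∥ Dom ∥) → proj₁ (toImg d) ≡ v a
    toImg-β a d = cong proj₁ (Img-prop (toImg d) (v a , ∣ a , refl ∣))

    ∐L-ub : (i : I) → α i ⊑L ∐L
    ∐L-ub i p = 𝓛-ext (λ p' → ∣ i , p' ∣) (λ _ → p) (λ p' → sym (toImg-β (i , p') ∣ i , p' ∣))

    ∐L-lb : (y : 𝓛 ℕ) → ((i : I) → α i ⊑L y) → ∐L ⊑L y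
    ∐L-lb y h d = ∥∥-rec (λ _ _ → uip _ _) (λ { (i , p) → trans (sym (∐L-ub i p)) (h i p) }) d

  open LSup using (∐L; ∐L-ub; ∐L-lb)

  𝓛ℕ : DCPO⊥
  𝓛ℕ = record
    { carrier   = 𝓛 ℕ
    ; _⊑_       = _⊑L_
    ; ⊑-prop    = λ l m f g → fe λ p → uip (f p) (g p)
    ; ⊑-refl    = λ l _ → refl
    ; ⊑-trans   = λ a b p → trans (a p) (b (subst isdefined (a p) p))
    ; ⊑-antisym = λ a b → 𝓛-ext (λ p → subst isdefined (a p) p) (λ q → subst isdefined (b q) q)
                                (λ p → value-≡ (a p) p _)
    ; bot       = ⊥𝓛
    ; bot-least = λ l ()
    ; ∐         = ∐L
    ; ∐-sup     = λ α δ → ∐L-ub α δ , ∐L-lb α δ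
    }

  𝓛-crit : (D : DCPO⊥) (f : ⟨ D ⟩ → 𝓛 ℕ)
           → ({x y : ⟨ D ⟩} → x ⊑⟨ D ⟩ y → f x ⊑L f y)
           → ({I : Set} (α : I → ⟨ D ⟩) (δ : isDirected (Rel D) α)
              → isdefined (f (∐ D α δ)) → ∥ Σ I (λ i → isdefined (f (α i))) ∥)
           → isContinuous D 𝓛ℕ f
  𝓛-crit D f m c α δ =
    (λ i → m (proj₁ (∐-sup D α δ) i)) ,
    (λ y h d → ∥∥-rec (λ _ _ → uip _ _)
                 (λ { (i , p) → trans (sym (m (proj₁ (∐-sup D α δ) i) p)) (h i p) }) (c α δ d))

  𝓛map : (ℕ → ℕ) → 𝓛 ℕ → 𝓛 ℕ
  𝓛map f l = proj₁ l , (λ p → f (value l p))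

  𝓛map-el : (ℕ → ℕ) → ⟨ 𝓛ℕ ⟹ 𝓛ℕ ⟩
  𝓛map-el f = 𝓛map f , 𝓛-crit 𝓛ℕ (𝓛map f) (λ a p → cong (𝓛map f) (a p)) (λ α δ d → d)

  _♯ : (ℕ → 𝓛 ℕ) → 𝓛 ℕ → 𝓛 ℕ
  (g ♯) l = (Σ (isdefined l) (λ p → isdefined (g (value l p))) ,
             Σ-isProp (isdefined-isProp l) (λ p → isdefined-isProp (g (value l p)))) ,
            (λ pd → value (g (value l (proj₁ pd))) (proj₂ pd))

  ♯-mono-l : (g : ℕ → 𝓛 ℕ) {l m : 𝓛 ℕ} → l ⊑L m → (g ♯) l ⊑L (g ♯) m
  ♯-mono-l g a (p , d) = cong (g ♯) (a p)

  ♯-crit-l : (g : ℕ → 𝓛 ℕ) {I : Set} (α : I → 𝓛 ℕ) (δ : isDirected _⊑L_ α)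
             → isdefined ((g ♯) (∐L α δ)) → ∥ Σ I (λ i → isdefined ((g ♯) (α i))) ∥
  ♯-crit-l g α δ (d , e) =
    ∥∥-rec ∥∥-isProp
      (λ { (i , p) → ∣ i , p , subst (λ n → isdefined (g n)) (value-≡ (sym (∐L-ub α δ i p)) d p) e ∣ })
      d

  ♯-mono-g : (g h : ℕ → 𝓛 ℕ) → ((n : ℕ) → g n ⊑L h n) → (l : 𝓛 ℕ) → (g ♯) l ⊑L (h ♯) l
  ♯-mono-g g h le l (p , d) = 𝓛-ext fwd bwd vals
    where
      fwd : isdefined ((g ♯) l) → isdefined ((h ♯) l)
      fwd (p' , d') = p' , subst isdefined (le _ d') d'
      bwd : isdefined ((h ♯) l) → isdefined ((g ♯) l)
      bwd (p' , _) = p' , subst (λ q → isdefined (g (value l q))) (isdefined-isProp l p p') d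
      vals : (pd : isdefined ((g ♯) l)) → value ((g ♯) l) pd ≡ value ((h ♯) l) (fwd pd)
      vals (p' , d') = value-≡ (le _ d') d' _

  ♯-crit-g : {J : Set} (h : J → ℕ → 𝓛 ℕ) (H : ℕ → 𝓛 ℕ)
             → ((n : ℕ) → isdefined (H n) → ∥ Σ J (λ j → isdefined (h j n)) ∥)
             → (l : 𝓛 ℕ) → isdefined ((H ♯) l) → ∥ Σ J (λ j → isdefined ((h j ♯) l)) ∥
  ♯-crit-g h H c l (p , d) = ∥∥-map (λ { (j , e) → j , p , e }) (c _ d)

  χ : 𝓛 ℕ → 𝓛 ℕ → ℕ → 𝓛 ℕ
  χ x y zero    = x
  χ x y (suc n) = y

  χ-mono : {x x' y y' : 𝓛 ℕ} → x ⊑L x' → y ⊑L y' → (n : ℕ) → χ x y n ⊑L χ x' y' n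
  χ-mono a b zero    = a
  χ-mono a b (suc n) = b

  χ-crit-x : (y : 𝓛 ℕ) {J : Set} (β : J → 𝓛 ℕ) (ε : isDirected _⊑L_ β) (n : ℕ)
             → isdefined (χ (∐L β ε) y n) → ∥ Σ J (λ j → isdefined (χ (β j) y n)) ∥
  χ-crit-x y β ε zero    d = d
  χ-crit-x y β ε (suc n) d = ∥∥-map (λ j → j , d) (proj₁ ε)

  χ-crit-y : (x : 𝓛 ℕ) {J : Set} (β : J → 𝓛 ℕ) (ε : isDirected _⊑L_ β) (n : ℕ)
             → isdefined (χ x (∐L β ε) n) → ∥ Σ J (λ j → isdefined (χ x (β j) n)) ∥
  χ-crit-y x β ε zero    d = ∥∥-map (λ j → j , d) (proj₁ ε)
  χ-crit-y x β ε (suc n) d = d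

  IF : 𝓛 ℕ → 𝓛 ℕ → 𝓛 ℕ → 𝓛 ℕ
  IF x y = (χ x y) ♯

  IF-cont-l : (x y : 𝓛 ℕ) → isContinuous 𝓛ℕ 𝓛ℕ (IF x y)
  IF-cont-l x y = 𝓛-crit 𝓛ℕ (IF x y) (♯-mono-l (χ x y)) (♯-crit-l (χ x y))

  IF-cont-y : (x l : 𝓛 ℕ) → isContinuous 𝓛ℕ 𝓛ℕ (λ y → IF x y l)
  IF-cont-y x l = 𝓛-crit 𝓛ℕ (λ y → IF x y l)
    (λ {y} {y'} b → ♯-mono-g (χ x y) (χ x y') (χ-mono (λ _ → refl) b) l)
    (λ β ε → ♯-crit-g (λ j → χ x (β j)) (χ x (∐L β ε)) (χ-crit-y x β ε) l)

  IF-cont-x : (y l : 𝓛 ℕ) → isContinuous 𝓛ℕ 𝓛ℕ (λ x → IF x y l)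
  IF-cont-x y l = 𝓛-crit 𝓛ℕ (λ x → IF x y l)
    (λ {x} {x'} a → ♯-mono-g (χ x y) (χ x' y) (χ-mono a (λ _ → refl)) l)
    (λ β ε → ♯-crit-g (λ j → χ (β j) y) (χ (∐L β ε) y) (χ-crit-x y β ε) l)

  IF₁ : 𝓛 ℕ → 𝓛 ℕ → ⟨ 𝓛ℕ ⟹ 𝓛ℕ ⟩
  IF₁ x y = IF x y , IF-cont-l x y

  IF₂ : 𝓛 ℕ → ⟨ 𝓛ℕ ⟹ 𝓛ℕ ⟹ 𝓛ℕ ⟩
  IF₂ x = (λ y → IF₁ x y) , curry-cont 𝓛ℕ 𝓛ℕ 𝓛ℕ (λ y l → IF x y l) (IF-cont-l x) (IF-cont-y x)

  ⟦ifz⟧ : ⟨ 𝓛ℕ ⟹ 𝓛ℕ ⟹ 𝓛ℕ ⟹ 𝓛ℕ ⟩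
  ⟦ifz⟧ = IF₂ , curry-cont 𝓛ℕ 𝓛ℕ (𝓛ℕ ⟹ 𝓛ℕ) IF₁ (λ x → proj₂ (IF₂ x))
                  (λ y → curry-cont 𝓛ℕ 𝓛ℕ 𝓛ℕ (λ x l → IF x y l) (λ x → IF-cont-l x y) (λ l → IF-cont-x y l))

  ⟦k⟧ : (D E : DCPO⊥) → ⟨ D ⟹ E ⟹ D ⟩
  ⟦k⟧ D E = (λ x → (λ _ → x) , const-cont E D x) ,
            curry-cont D E D (λ x _ → x) (λ x → const-cont E D x) (λ _ → id-cont D)

  module S (D E F : DCPO⊥) where
    S₀-cont : (f : ⟨ D ⟹ E ⟹ F ⟩) (g : ⟨ D ⟹ E ⟩)
              → isContinuous D F (λ x → proj₁ (proj₁ f x) (proj₁ g x))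
    S₀-cont f g α δ = ub , lb
      where
        f' = proj₁ f
        g' = proj₁ g
        sα = ∐ D α δ
        ub : ∀ i → proj₁ (f' (α i)) (g' (α i)) ⊑⟨ F ⟩ proj₁ (f' sα) (g' sα)
        ub i = ⊑-trans F (mono-el E F (f' (α i)) (mono-el D E g (proj₁ (∐-sup D α δ) i)))
                         (mono-el D (E ⟹ F) f (proj₁ (∐-sup D α δ) i) (g' sα))
        lb : ∀ y → (∀ i → proj₁ (f' (α i)) (g' (α i)) ⊑⟨ F ⟩ y) → proj₁ (f' sα) (g' sα) ⊑⟨ F ⟩ y
        lb y h = proj₂ (comp-cont D (E ⟹ F) F f' (λ φ → proj₁ φ (g' sα)) (proj₂ f)
                          (eval-cont E F (g' sα)) α δ) y
                   (λ i → proj₂ (cont-preserves E F (proj₁ (f' (α i))) (proj₂ (f' (α i)))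
                                   (image-dir D E g' (mono-el D E g) δ) (proj₂ g α δ)) y
                     (λ j → ∥∥-rec (⊑-prop F _ y)
                              (λ { (k , a , b) →
                                   ⊑-trans F (⊑-trans F (mono-el E F (f' (α i)) (mono-el D E g b))
                                                        (mono-el D (E ⟹ F) f a (g' (α k))))
                                             (h k) })
                              (proj₂ δ i j)))

    S₀ : ⟨ D ⟹ E ⟹ F ⟩ → ⟨ D ⟹ E ⟩ → ⟨ D ⟹ F ⟩
    S₀ f g = (λ x → proj₁ (proj₁ f x) (proj₁ g x)) , S₀-cont f g

    S₁ : ⟨ D ⟹ E ⟹ F ⟩ → ⟨ (D ⟹ E) ⟹ D ⟹ F ⟩
    S₁ f = S₀ f , curry-cont (D ⟹ E) D F (λ g x → proj₁ (proj₁ f x) (proj₁ g x)) (S₀-cont f)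
                    (λ x → comp-cont (D ⟹ E) E F (λ g → proj₁ g x) (proj₁ (proj₁ f x))
                              (eval-cont D E x) (proj₂ (proj₁ f x)))

    ⟦s⟧ : ⟨ (D ⟹ E ⟹ F) ⟹ (D ⟹ E) ⟹ D ⟹ F ⟩
    ⟦s⟧ = S₁ , curry-cont (D ⟹ E ⟹ F) (D ⟹ E) (D ⟹ F) S₀ (λ f → proj₂ (S₁ f))
                 (λ g → curry-cont (D ⟹ E ⟹ F) D F (λ f x → proj₁ (proj₁ f x) (proj₁ g x))
                          (λ f → S₀-cont f g)
                          (λ x → comp-cont (D ⟹ E ⟹ F) (E ⟹ F) F (λ f → proj₁ f x)
                                    (λ φ → proj₁ φ (proj₁ g x))
                                    (eval-cont D (E ⟹ F) x) (eval-cont E F (proj₁ g x))))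

  module Fix (D : DCPO⊥) where
    iter : ⟨ D ⟹ D ⟩ → ℕ → ⟨ D ⟩
    iter f zero    = bot D
    iter f (suc n) = proj₁ f (iter f n)

    iter-step : (f : ⟨ D ⟹ D ⟩) (n : ℕ) → iter f n ⊑⟨ D ⟩ iter f (suc n)
    iter-step f zero    = bot-least D _
    iter-step f (suc n) = mono-el D D f (iter-step f n)

    iter-up : (f : ⟨ D ⟹ D ⟩) (n d : ℕ) → iter f n ⊑⟨ D ⟩ iter f (d + n)
    iter-up f n zero    = ⊑-refl D _
    iter-up f n (suc d) = ⊑-trans D (iter-up f n d) (iter-step f (d + n))

    iter-dir : (f : ⟨ D ⟹ D ⟩) → isDirected (Rel D) (iter f)
    iter-dir f = ∣ zero ∣ , λ i j →
      ∣ j + i , iter-up f i j , subst (λ k → iter f j ⊑⟨ D ⟩ iter f k) (+-comm i j) (iter-up f j i) ∣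

    fixD : ⟨ D ⟹ D ⟩ → ⟨ D ⟩
    fixD f = ∐ D (iter f) (iter-dir f)

    iter-monoF : {f g : ⟨ D ⟹ D ⟩} → f ⊑⟨ D ⟹ D ⟩ g → (n : ℕ) → iter f n ⊑⟨ D ⟩ iter g n
    iter-monoF le zero    = ⊑-refl D _
    iter-monoF {f} {g} le (suc n) = ⊑-trans D (mono-el D D f (iter-monoF le n)) (le (iter g n))

    fix-cont : isContinuous (D ⟹ D) D fixD
    fix-cont {J} β ε = ub , lb
      where
        sβ = ∐ (D ⟹ D) β ε
        ub : ∀ j → fixD (β j) ⊑⟨ D ⟩ fixD sβ
        ub j = proj₂ (∐-sup D (iter (β j)) (iter-dir (β j))) (fixD sβ)
                 (λ n → ⊑-trans D (iter-monoF (proj₁ (∐-sup (D ⟹ D) β ε) j) n)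
                                   (proj₁ (∐-sup D (iter sβ) (iter-dir sβ)) n))
        dirn : (n : ℕ) → isDirected (Rel D) (λ j → iter (β j) n)
        dirn n = proj₁ ε , λ i j → ∥∥-map (λ { (k , a , b) → k , iter-monoF a n , iter-monoF b n })
                                          (proj₂ ε i j)
        key : (n : ℕ) (z : ⟨ D ⟩) → (∀ j → iter (β j) n ⊑⟨ D ⟩ z) → iter sβ n ⊑⟨ D ⟩ z
        key zero    z h = bot-least D z
        key (suc n) z h = proj₂ (∐-sup D _ _) z T
          where
            w = ∐ D (λ j → iter (β j) n) (dirn n)
            xn⊑w : iter sβ n ⊑⟨ D ⟩ w
            xn⊑w = key n w (proj₁ (∐-sup D _ (dirn n)))
            T : ∀ j → proj₁ (β j) (iter sβ n) ⊑⟨ D ⟩ z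
            T j = ⊑-trans D (mono-el D D (β j) xn⊑w)
                    (proj₂ (proj₂ (β j) (λ j' → iter (β j') n) (dirn n)) z
                      (λ j' → ∥∥-rec (⊑-prop D _ z)
                                (λ { (k , a , b) → ⊑-trans D (⊑-trans D (mono-el D D (β j) (iter-monoF b n))
                                                                         (a (iter (β k) n)))
                                                             (h k) })
                                (proj₂ ε j j')))
        lb : ∀ y → (∀ j → fixD (β j) ⊑⟨ D ⟩ y) → fixD sβ ⊑⟨ D ⟩ y
        lb y h = proj₂ (∐-sup D (iter sβ) (iter-dir sβ)) y
                   (λ n → key n y (λ j → ⊑-trans D (proj₁ (∐-sup D (iter (β j)) (iter-dir (β j))) n) (h j)))

    ⟦fix⟧ : ⟨ (D ⟹ D) ⟹ D ⟩
    ⟦fix⟧ = fixD , fix-cont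

  ⟦_⟧ty : Ty → DCPO⊥
  ⟦ ι ⟧ty     = 𝓛ℕ
  ⟦ σ ⇒ τ ⟧ty = ⟦ σ ⟧ty ⟹ ⟦ τ ⟧ty

  ⟦_⟧ : {σ : Ty} → Term σ → ⟨ ⟦ σ ⟧ty ⟩
  ⟦ zero' ⟧ = η zero
  ⟦ succ' ⟧ = 𝓛map-el suc
  ⟦ pred' ⟧ = 𝓛map-el pred
  ⟦ ifz ⟧   = ⟦ifz⟧
  ⟦ 𝐤 {σ} {τ} ⟧ = ⟦k⟧ ⟦ σ ⟧ty ⟦ τ ⟧ty
  ⟦ 𝐬 {σ} {τ} {ρ} ⟧ = S.⟦s⟧ ⟦ σ ⟧ty ⟦ τ ⟧ty ⟦ ρ ⟧ty
  ⟦ fix {σ} ⟧ = Fix.⟦fix⟧ ⟦ σ ⟧ty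
  ⟦ s · t ⟧ = proj₁ ⟦ s ⟧ ⟦ t ⟧

{-# OPTIONS --safe #-}
-- Soundness: a reduction step does not change the denotation, so a term reducing to a numeral
-- has a defined denotation.  Adequacy: relate a denotation x : ⟦ σ ⟧ to a term t : σ by
-- "whenever x is defined, t reduces to the numeral of its value" at ι, extended to function
-- types as a logical relation.  The relation contains ⊥, is closed under directed suprema and
-- under backward reduction, so it holds between every term and its denotation (fix via its
-- approximants fⁿ(⊥)).  The truncation is harmless: the truncated statement implies the
-- proposition isdefined ⟦ t ⟧, whose value is the numeral.
module Submission where

open import Defs
open import Data.Nat using (ℕ; zero; suc; pred)
open import Data.Product using (Σ; _×_; _,_; proj₁; proj₂)
open import Data.Unit using (tt)
open import Function.Bundles using (_⇔_; mk⇔)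
open import Level using (Lift; lift; lower)
open import Relation.Binary.PropositionalEquality
open import Axiom.UniquenessOfIdentityProofs.WithK using (uip)

module Adequacy (pt : PropTrunc) (fe : FunExt) (pe : PropExt) where
  open Model pt fe pe

  ~⇝⇒⇝* : {σ : Ty} {s t : Term σ} → s ~⇝ t → s ⇝* t
  ~⇝⇒⇝* r = ∣ extend ∣ r ∣ ∣

  ⇝*-refl : {σ : Ty} {t : Term σ} → t ⇝* t
  ⇝*-refl = ∣ refl* ∣

  ⇝*-trans : {σ : Ty} {r s t : Term σ} → r ⇝* s → s ⇝* t → r ⇝* t
  ⇝*-trans p q = ∥∥-rec ∥∥-isProp (λ x → ∥∥-map (trans* x) q) p

  Star-cong : {σ τ : Ty} (C : Term σ → Term τ) → (∀ {s t} → s ~⇝ t → C s ~⇝ C t)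
              → ∀ {s t} → Star _⇝_ s t → Star _⇝_ (C s) (C t)
  Star-cong C c (extend r)   = extend (∥∥-map c r)
  Star-cong C c refl*        = refl*
  Star-cong C c (trans* p q) = trans* (Star-cong C c p) (Star-cong C c q)

  ⇝*-cong : {σ τ : Ty} (C : Term σ → Term τ) → (∀ {s t} → s ~⇝ t → C s ~⇝ C t)
            → ∀ {s t} → s ⇝* t → C s ⇝* C t
  ⇝*-cong C c = ∥∥-map (Star-cong C c)

  ⟦numeral⟧ : (n : ℕ) → ⟦ numeral n ⟧ ≡ η n
  ⟦numeral⟧ zero    = refl
  ⟦numeral⟧ (suc n) = cong (𝓛map suc) (⟦numeral⟧ n)

  fixD-unfold : (D : DCPO⊥) (f : ⟨ D ⟹ D ⟩) → Fix.fixD D f ≡ proj₁ f (Fix.fixD D f)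
  fixD-unfold D f = ⊑-antisym D fix⊑f[fix] f[fix]⊑fix
    where
      open Fix D
      iter⊑fix : ∀ n → iter f n ⊑⟨ D ⟩ fixD f
      iter⊑fix = proj₁ (∐-sup D (iter f) (iter-dir f))
      fix⊑f[fix] : fixD f ⊑⟨ D ⟩ proj₁ f (fixD f)
      fix⊑f[fix] = proj₂ (∐-sup D (iter f) (iter-dir f)) _
                     (λ n → ⊑-trans D (iter-step f n) (mono-el D D f (iter⊑fix n)))
      f[fix]⊑fix : proj₁ f (fixD f) ⊑⟨ D ⟩ fixD f
      f[fix]⊑fix = proj₂ (proj₂ f (iter f) (iter-dir f)) (fixD f) (λ n → iter⊑fix (suc n))

  IF-η-zero : (x y : 𝓛 ℕ) → IF x y (η zero) ≡ x
  IF-η-zero x y = 𝓛-ext proj₂ (λ d → tt , d) (λ _ → refl)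

  IF-η-suc : (x y : 𝓛 ℕ) (n : ℕ) → IF x y (η (suc n)) ≡ y
  IF-η-suc x y n = 𝓛-ext proj₂ (λ d → tt , d) (λ _ → refl)

  ~⇝-sound : {σ : Ty} {s t : Term σ} → s ~⇝ t → ⟦ s ⟧ ≡ ⟦ t ⟧
  ~⇝-sound pred-zero          = refl
  ~⇝-sound (pred-suc n)       = trans (cong (𝓛map pred) (⟦numeral⟧ (suc n))) (sym (⟦numeral⟧ n))
  ~⇝-sound (ifz-zero s t)     = IF-η-zero ⟦ s ⟧ ⟦ t ⟧
  ~⇝-sound (ifz-suc s t n)    = trans (cong (IF ⟦ s ⟧ ⟦ t ⟧) (⟦numeral⟧ (suc n))) (IF-η-suc ⟦ s ⟧ ⟦ t ⟧ n)
  ~⇝-sound (k-step s t)       = refl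
  ~⇝-sound (s-step f g t)     = refl
  ~⇝-sound (fix-step {σ} f)   = fixD-unfold ⟦ σ ⟧ty ⟦ f ⟧
  ~⇝-sound (app-cong t r)     = cong (λ f → proj₁ f ⟦ t ⟧) (~⇝-sound r)
  ~⇝-sound (succ-cong r)      = cong (𝓛map suc) (~⇝-sound r)
  ~⇝-sound (pred-cong r)      = cong (𝓛map pred) (~⇝-sound r)
  ~⇝-sound (ifz-cong s t r)   = cong (IF ⟦ s ⟧ ⟦ t ⟧) (~⇝-sound r)

  Star-sound : {σ : Ty} {s t : Term σ} → Star _⇝_ s t → ⟦ s ⟧ ≡ ⟦ t ⟧
  Star-sound (extend r)   = ∥∥-rec uip ~⇝-sound r
  Star-sound refl*        = refl
  Star-sound (trans* p q) = trans (Star-sound p) (Star-sound q)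

  ⇝*-sound : {σ : Ty} {s t : Term σ} → s ⇝* t → ⟦ s ⟧ ≡ ⟦ t ⟧
  ⇝*-sound = ∥∥-rec uip Star-sound

  ⇝*numeral⇒isdefined : (t : Term ι) (n : ℕ) → t ⇝* numeral n → isdefined ⟦ t ⟧
  ⇝*numeral⇒isdefined t n r = subst isdefined (sym (trans (⇝*-sound r) (⟦numeral⟧ n))) tt

  Approx : (σ : Ty) → ⟨ ⟦ σ ⟧ty ⟩ → Term σ → Set₁
  Approx ι       x t = Lift _ ((p : isdefined x) → t ⇝* numeral (value x p))
  Approx (σ ⇒ τ) f s = (x : ⟨ ⟦ σ ⟧ty ⟩) (t : Term σ) → Approx σ x t → Approx τ (proj₁ f x) (s · t)

  Approx-expand : (σ : Ty) {x : ⟨ ⟦ σ ⟧ty ⟩} {s s' : Term σ} → s ⇝* s' → Approx σ x s' → Approx σ x s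
  Approx-expand ι       r a = lift λ p → ⇝*-trans r (lower a p)
  Approx-expand (σ ⇒ τ) r a = λ x t b → Approx-expand τ (⇝*-cong (_· t) (app-cong t) r) (a x t b)

  Approx-bot : (σ : Ty) (t : Term σ) → Approx σ (bot ⟦ σ ⟧ty) t
  Approx-bot ι       t = lift λ ()
  Approx-bot (σ ⇒ τ) s = λ x t _ → Approx-bot τ (s · t)

  Approx-∐ : (σ : Ty) {I : Set} (α : I → ⟨ ⟦ σ ⟧ty ⟩) (δ : isDirected (Rel ⟦ σ ⟧ty) α) (t : Term σ)
             → (∀ i → Approx σ (α i) t) → Approx σ (∐ ⟦ σ ⟧ty α δ) t
  Approx-∐ ι α δ t a = lift λ p → ∥∥-rec ∥∥-isProp
    (λ { (i , pᵢ) → subst (λ m → t ⇝* numeral m) (value-≡ (LSup.∐L-ub α δ i pᵢ) pᵢ p) (lower (a i) pᵢ) }) p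
  Approx-∐ (σ ⇒ τ) α δ s a = λ x t b → Approx-∐ τ (λ i → proj₁ (α i) x) _ (s · t) (λ i → a i x t b)

  pred-⇝*numeral : (t : Term ι) (n : ℕ) → t ⇝* numeral n → pred' · t ⇝* numeral (pred n)
  pred-⇝*numeral t zero    r = ⇝*-trans (⇝*-cong (pred' ·_) pred-cong r) (~⇝⇒⇝* pred-zero)
  pred-⇝*numeral t (suc n) r = ⇝*-trans (⇝*-cong (pred' ·_) pred-cong r) (~⇝⇒⇝* (pred-suc n))

  ifz-⇝*numeral : (x y : 𝓛 ℕ) (s s' r : Term ι) → Approx ι x s → Approx ι y s'
                  → (n : ℕ) → r ⇝* numeral n
                  → (d : isdefined (χ x y n)) → ifz · s · s' · r ⇝* numeral (value (χ x y n) d)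
  ifz-⇝*numeral x y s s' r a b n rn d =
    ⇝*-trans (⇝*-cong (ifz · s · s' ·_) (ifz-cong s s') rn) (branch n d)
    where
      branch : (n : ℕ) (d : isdefined (χ x y n)) → ifz · s · s' · numeral n ⇝* numeral (value (χ x y n) d)
      branch zero    d = ⇝*-trans (~⇝⇒⇝* (ifz-zero s s')) (lower a d)
      branch (suc n) d = ⇝*-trans (~⇝⇒⇝* (ifz-suc s s' n)) (lower b d)

  Approx-fix : (σ : Ty) (f : ⟨ ⟦ σ ⟧ty ⟹ ⟦ σ ⟧ty ⟩) (s : Term (σ ⇒ σ)) → Approx (σ ⇒ σ) f s
               → Approx σ (Fix.fixD ⟦ σ ⟧ty f) (fix · s)
  Approx-fix σ f s a = Approx-∐ σ (iter f) (iter-dir f) (fix · s) Approx-iter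
    where
      open Fix ⟦ σ ⟧ty
      Approx-iter : ∀ n → Approx σ (iter f n) (fix · s)
      Approx-iter zero    = Approx-bot σ _
      Approx-iter (suc n) = Approx-expand σ (~⇝⇒⇝* (fix-step s)) (a (iter f n) (fix · s) (Approx-iter n))

  Approx-⟦⟧ : {σ : Ty} (t : Term σ) → Approx σ ⟦ t ⟧ t
  Approx-⟦⟧ zero'           = lift λ _ → ⇝*-refl
  Approx-⟦⟧ succ'           = λ x t a → lift λ p → ⇝*-cong (succ' ·_) succ-cong (lower a p)
  Approx-⟦⟧ pred'           = λ x t a → lift λ p → pred-⇝*numeral t (value x p) (lower a p)
  Approx-⟦⟧ ifz             = λ x s a y s' b l r c →
    lift λ { (p , d) → ifz-⇝*numeral x y s s' r a b (value l p) (lower c p) d }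
  Approx-⟦⟧ (𝐤 {σ})         = λ x s a y t _ → Approx-expand σ (~⇝⇒⇝* (k-step s t)) a
  Approx-⟦⟧ (𝐬 {ρ = ρ})     = λ f s a g s' b x t c →
    Approx-expand ρ (~⇝⇒⇝* (s-step s s' t)) (a x t c (proj₁ g x) (s' · t) (b x t c))
  Approx-⟦⟧ (fix {σ})       = Approx-fix σ
  Approx-⟦⟧ (s · t)         = Approx-⟦⟧ s ⟦ t ⟧ t (Approx-⟦⟧ t)

  isdefined⇒⇝*numeral : (t : Term ι) → isdefined ⟦ t ⟧ → Σ ℕ (λ n → t ⇝* numeral n)
  isdefined⇒⇝*numeral t p = value ⟦ t ⟧ p , lower (Approx-⟦⟧ t) p

lemma8p1 : (pt : PropTrunc) (fe : FunExt) (pe : PropExt)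
    → let open Model pt fe pe in
    (t : Term ι)
    → (isdefined ⟦ t ⟧ ⇔ Σ ℕ (λ n → t ⇝* numeral n))
    × (Σ ℕ (λ n → t ⇝* numeral n) ⇔ ∥ Σ ℕ (λ n → t ⇝* numeral n) ∥)
lemma8p1 pt fe pe t =
  mk⇔ (isdefined⇒⇝*numeral t) sound ,
  mk⇔ ∣_∣ (λ e → isdefined⇒⇝*numeral t (∥∥-rec (isdefined-isProp ⟦ t ⟧) sound e))
  where
    open Model pt fe pe
    open Adequacy pt fe pe
    sound : Σ ℕ (λ n → t ⇝* numeral n) → isdefined ⟦ t ⟧
    sound (n , r) = ⇝*numeral⇒isdefined t n r
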